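{- Let $T$ be a finite tree with at least two vertices and a proper 2-coloring $\chi:V(T)\to\{\mathcal{R},\mathcal{B}\}$, and let $T_\mathcal{B}$, $T_\mathcal{R}$ be the subgraphs of $T$ induced by $V(T)\setminus N[V_1(T)\cap\chi^{ -1}(\mathcal{B})]$ and $V(T)\setminus N[V_1(T)\cap\chi^{ -1}(\mathcal{R})]$ respectively. Let $D\subseteq V(T)$. Then $D$ is a minimal blue-dominating set in $T$ if and only if $D=(V_1(T)\cap V_\mathcal{R}(T))\cup D'$ where $D'$ is a minimal blue-dominating set in $T_\mathcal{R}$. Similarly, $D$ is a minimal red-dominating set in $T$ if and only if $D=(V_1(T)\cap V_\mathcal{B}(T))\cup D'$ where $D'$ is a minimal red-dominating set in $T_\mathcal{B}$.
   Context: For a graph $H$, $N_H(S)$ is the union of open neighborhoods in $H$ of vertices of $S$, and $N[S]=N(S)\cup S$. A leaf is a vertex of degree 1; the height of a vertex is its minimum distance to a leaf; $V_1(T)$ is the set of vertices of height 1 in $T$. $V_\mathcal{R}(H)$ and $V_\mathcal{B}(H)$ are the red and blue vertices of $H$ (coloring restricted from $T$). A blue-dominating set of $H$ is a set $D$ with $N_H(D)=V_\mathcal{B}(H)$, a red-dominating set one with $N_H(D)=V_\mathcal{R}(H)$; such a set is minimal if no proper subset $D''\subsetneq D$ has $N_H(D'')=N_H(D)$. -}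

module Defs where

open import Data.Nat using (ℕ; zero; suc; _≤_)
open import Data.Bool using (Bool; true; false)
open import Data.Fin using (Fin)
open import Data.Fin.Subset using (Subset; _∈_; _⊂_; ∣_∣)
open import Data.Vec using (tabulate)
open import Data.List using (List; []; _∷_; _∷ʳ_; length)
open import Data.List.Relation.Unary.Linked using (Linked)
open import Data.List.Relation.Unary.Unique.Propositional using (Unique)
open import Data.Product using (_×_; ∃; Σ)
open import Data.Sum using (_⊎_)
open import Data.Empty using (⊥)
open import Data.Unit using (⊤)
open import Relation.Binary.PropositionalEquality using (_≡_; _≢_)
open import Relation.Nullary using (¬_)
open import Function.Bundles using (_⇔_)

record Graph (n : ℕ) : Set where
  field
    adj    : Fin n → Fin n → Bool
    irrefl : ∀ v → adj v v ≡ false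
    sym    : ∀ u v → adj u v ≡ adj v u

data Color : Set where
  red blue : Color

VSet : ℕ → Set₁
VSet n = Fin n → Set

_≐_ : ∀ {n} → VSet n → VSet n → Set
P ≐ Q = ∀ v → P v ⇔ Q v

module _ {n : ℕ} (G : Graph n) where
  open Graph G

  Adj : Fin n → Fin n → Set
  Adj u v = adj u v ≡ true

  data Walk : Fin n → Fin n → ℕ → Set where
    []  : ∀ {v} → Walk v v 0
    _∷_ : ∀ {u v w k} → Adj u v → Walk v w k → Walk u w (suc k)

  Connected : Set
  Connected = ∀ u v → ∃ λ k → Walk u v k

  IsCycle : List (Fin n) → Set
  IsCycle []       = ⊥
  IsCycle (x ∷ xs) = 2 ≤ length xs × Unique (x ∷ xs) × Linked Adj ((x ∷ xs) ∷ʳ x)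

  Acyclic : Set
  Acyclic = ∀ c → ¬ IsCycle c

  IsTree : Set
  IsTree = Connected × Acyclic

  ProperColoring : (Fin n → Color) → Set
  ProperColoring χ = ∀ u v → Adj u v → χ u ≢ χ v

  degree : Fin n → ℕ
  degree v = ∣ tabulate (adj v) ∣

  Leaf : Fin n → Set
  Leaf v = degree v ≡ 1

  HasHeight : Fin n → ℕ → Set
  HasHeight v h = (∃ λ ℓ → Leaf ℓ × ∃ λ m → m ≤ h × Walk v ℓ m)
                × (∀ ℓ m → Leaf ℓ → Walk v ℓ m → h ≤ m)

  V₁ : VSet n
  V₁ v = HasHeight v 1

  ClosedNbhd : VSet n → VSet n
  ClosedNbhd P v = P v ⊎ ∃ λ u → P u × Adj u v

  -- Everything below concerns the subgraph H of G induced by the vertex set S.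
  -- Open neighbourhood N_H(D) of D ⊆ V(H)
  N : VSet n → Subset n → VSet n
  N S D v = S v × ∃ λ u → u ∈ D × Adj u v

  Colored : VSet n → (Fin n → Color) → Color → VSet n
  Colored S χ c v = S v × χ v ≡ c

  Dominating : VSet n → (Fin n → Color) → Color → Subset n → Set
  Dominating S χ c D = (∀ v → v ∈ D → S v) × (N S D ≐ Colored S χ c)

  MinimalDominating : VSet n → (Fin n → Color) → Color → Subset n → Set
  MinimalDominating S χ c D =
    Dominating S χ c D × ¬ (∃ λ D'' → D'' ⊂ D × (N S D'' ≐ N S D))

  AllV : VSet n
  AllV _ = ⊤

  RemovedV : (Fin n → Color) → Color → VSet n
  RemovedV χ c v = ¬ ClosedNbhd (λ u → V₁ u × χ u ≡ c) v

{-# OPTIONS --safe #-}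
module Submission where

-- Write o for the colour opposite to c and P for the height-one vertices of colour o.
-- Every vertex has a neighbour, and a c-dominating set D dominates only c-vertices, so
-- D lies in colour class o; and D ⊇ P, since the leaf hanging at p ∈ P has colour c
-- and p as its only neighbour.  Let S = V ∖ N[P].  No vertex of P has a neighbour in S,
-- so N(D) ∩ S = N_S(D ∖ P); outside S, every c-vertex is already adjacent to P.  Hence
-- D ↦ D ∖ P identifies c-dominating sets of T with c-dominating sets of T[S] (plus P),
-- and a proper subset with the same neighbourhood on one side gives one on the other.

open import Defs
open import Data.Nat using (ℕ; _≤_; _<_; z≤n; s≤s)
open import Data.Nat.Properties using (≤-refl; <-irrefl)
import Data.Nat as ℕ
open import Data.Bool using (Bool; true)
import Data.Bool as Bool
open import Data.Fin using (Fin; zero; suc)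
import Data.Fin as Fin
open import Data.Fin.Properties using (any?)
open import Data.Fin.Subset using (Subset; _∈_; _∉_; _⊆_; _⊂_; _∩_; _∪_; ∁; ⁅_⁆; ∣_∣)
open import Data.Fin.Subset.Properties
  using (x∈p∩q⁺; x∈p∩q⁻; x∈p∪q⁺; x∈p∪q⁻; x∉p⇒x∈∁p; x∈∁p⇒x∉p; ⊆-antisym;
         p⊂q⇒∣p∣<∣q∣; ∣⁅x⁆∣≡1; x∈⁅y⁆⇒x≡y)
open import Data.Vec using (tabulate)
open import Data.Vec.Properties using (lookup∘tabulate; []=⇒lookup; lookup⇒[]=)
open import Data.Product using (_×_; ∃; _,_; proj₁; proj₂; map₂)
open import Data.Sum using (_⊎_; inj₁; inj₂; [_,_]′)
open import Data.Unit using (tt)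
open import Function using (_∘_; id; flip)
open import Function.Bundles using (_⇔_; mk⇔; Equivalence)
open import Function.Properties.Equivalence using () renaming (trans to ⇔-trans)
open import Relation.Binary.PropositionalEquality
  using (_≡_; _≢_; refl; sym; trans; subst; subst₂; cong)
open import Relation.Nullary using (¬_; Dec; yes; no; does; contradiction)
open import Relation.Nullary.Decidable
  using (_×-dec_; _⊎-dec_; ¬?; map′; dec-true; decidable-stable)
open import Relation.Unary using (Pred; Decidable)

open Equivalence using (to; from)

∈-tabulate⁺ : ∀ {n} {f : Fin n → Bool} {x} → f x ≡ true → x ∈ tabulate f
∈-tabulate⁺ {f = f} {x} fx = lookup⇒[]= x (tabulate f) (trans (lookup∘tabulate f x) fx)

∈-tabulate⁻ : ∀ {n} {f : Fin n → Bool} {x} → x ∈ tabulate f → f x ≡ true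
∈-tabulate⁻ {f = f} {x} x∈ = trans (sym (lookup∘tabulate f x)) ([]=⇒lookup x∈)

∣p∣≡1⇒x≡y : ∀ {n} {p : Subset n} {x y} → ∣ p ∣ ≡ 1 → x ∈ p → y ∈ p → x ≡ y
∣p∣≡1⇒x≡y {p = p} {x} {y} ∣p∣≡1 x∈p y∈p with x Fin.≟ y
... | yes x≡y = x≡y
... | no  x≢y = contradiction (subst₂ _<_ (∣⁅x⁆∣≡1 x) ∣p∣≡1 (p⊂q⇒∣p∣<∣q∣ ⁅x⁆⊂p)) (<-irrefl refl)
  where
  ⁅x⁆⊂p : ⁅ x ⁆ ⊂ p
  ⁅x⁆⊂p = (λ z∈⁅x⁆ → subst (_∈ p) (sym (x∈⁅y⁆⇒x≡y x z∈⁅x⁆)) x∈p)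
        , y , y∈p , x≢y ∘ sym ∘ x∈⁅y⁆⇒x≡y x

select : ∀ {n ℓ} {P : Pred (Fin n) ℓ} → Decidable P → Subset n
select P? = tabulate (does ∘ P?)

module _ {n ℓ} {P : Pred (Fin n) ℓ} (P? : Decidable P) where

  ∈-select⁺ : ∀ {x} → P x → x ∈ select P?
  ∈-select⁺ {x} px = ∈-tabulate⁺ (dec-true (P? x) px)

  ∈-select⁻ : ∀ {x} → x ∈ select P? → P x
  ∈-select⁻ {x} x∈ = witness (P? x) (∈-tabulate⁻ x∈)
    where
    witness : (d : Dec (P x)) → does d ≡ true → P x
    witness (yes px) _ = px

another-vertex : ∀ {n} → 2 ≤ n → (v : Fin n) → ∃ λ u → v ≢ u
another-vertex (s≤s (s≤s _)) zero    = suc zero , λ ()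
another-vertex (s≤s (s≤s _)) (suc _) = zero , λ ()

_≟ᶜ_ : (c d : Color) → Dec (c ≡ d)
red  ≟ᶜ red  = yes refl
red  ≟ᶜ blue = no λ ()
blue ≟ᶜ red  = no λ ()
blue ≟ᶜ blue = yes refl

opposite : Color → Color
opposite red  = blue
opposite blue = red

opposite-involutive : ∀ c → opposite (opposite c) ≡ c
opposite-involutive red  = refl
opposite-involutive blue = refl

opposite-≢ : ∀ c → c ≢ opposite c
opposite-≢ red  ()
opposite-≢ blue ()

Redundant : ∀ {n} → Graph n → VSet n → Subset n → Set
Redundant G S D = ∃ λ D'' → D'' ⊂ D × (N G S D'' ≐ N G S D)

module _ {n : ℕ} (G : Graph n) where

  Adj-sym : ∀ {u v} → Adj G u v → Adj G v u
  Adj-sym {u} {v} a = trans (Graph.sym G v u) a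

  N-mono : ∀ {S D₁ D₂ v} → D₁ ⊆ D₂ → N G S D₁ v → N G S D₂ v
  N-mono D₁⊆D₂ (sv , u , u∈D₁ , a) = sv , u , D₁⊆D₂ u∈D₁ , a

  N-forget : ∀ {S D v} → N G S D v → N G (AllV G) D v
  N-forget (_ , u∈D) = tt , u∈D

  ClosedNbhd? : ∀ {P : VSet n} → Decidable P → Decidable (ClosedNbhd G P)
  ClosedNbhd? P? v = P? v ⊎-dec any? (λ u → P? u ×-dec (Graph.adj G u v Bool.≟ true))

  walk⇒nbr : ∀ {u v k} → Walk G u v k → u ≢ v → ∃ (Adj G u)
  walk⇒nbr []      u≢u = contradiction refl u≢u
  walk⇒nbr (a ∷ _) _   = _ , a

  connected⇒nbr : 2 ≤ n → Connected G → ∀ v → ∃ (Adj G v)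
  connected⇒nbr 2≤n connected v with another-vertex 2≤n v
  ... | u , v≢u = walk⇒nbr (proj₂ (connected v u)) v≢u

  module _ {χ : Fin n → Color} (proper : ProperColoring G χ) where

    proper⇒opposite : ∀ {u v} → Adj G u v → χ v ≡ opposite (χ u)
    proper⇒opposite {u} {v} a with χ u in χu | χ v in χv
    ... | red  | blue = refl
    ... | blue | red  = refl
    ... | red  | red  = contradiction (trans χu (sym χv)) (proper u v a)
    ... | blue | blue = contradiction (trans χu (sym χv)) (proper u v a)

    next-to-opposite : ∀ {c u v} → Adj G u v → χ u ≡ opposite c → χ v ≡ c
    next-to-opposite {c} a χu =
      trans (proper⇒opposite a) (trans (cong opposite χu) (opposite-involutive c))

    next-to : ∀ {c u v} → Adj G u v → χ v ≡ c → χ u ≡ opposite c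
    next-to a χv = trans (proper⇒opposite (Adj-sym a)) (cong opposite χv)

    dominator-colour : ∀ {S c D u x} → Dominating G S χ c D →
                       u ∈ D → Adj G u x → S x → χ u ≡ opposite c
    dominator-colour (_ , N≐) u∈D a sx = next-to a (proj₂ (to (N≐ _) (sx , _ , u∈D , a)))

module ForcedVertices {n : ℕ} (G : Graph n) {χ : Fin n → Color} (proper : ProperColoring G χ)
  (c : Color)
  (has-nbr : ∀ v → ∃ (Adj G v))
  {P : VSet n} (P? : Decidable P)
  (P-colour : ∀ {v} → P v → χ v ≡ opposite c)
  (P-forced : ∀ {D v} → Dominating G (AllV G) χ c D → P v → v ∈ D) where

  S : VSet n
  S v = ¬ ClosedNbhd G P v

  S? : Decidable S
  S? = ¬? ∘ ClosedNbhd? G P?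

  ¬S⇒N[P] : ∀ {v} → ¬ S v → ClosedNbhd G P v
  ¬S⇒N[P] {v} = decidable-stable (ClosedNbhd? G P? v)

  _∖P : Subset n → Subset n
  D ∖P = D ∩ ∁ (select P?)

  ∈-∖P⁺ : ∀ {D u} → u ∈ D → ¬ P u → u ∈ D ∖P
  ∈-∖P⁺ u∈D ¬pu = x∈p∩q⁺ (u∈D , x∉p⇒x∈∁p (¬pu ∘ ∈-select⁻ P?))

  ∈-∖P⁻ : ∀ {D u} → u ∈ D ∖P → u ∈ D × ¬ P u
  ∈-∖P⁻ {D} u∈ = map₂ (λ u∈∁P → x∈∁p⇒x∉p u∈∁P ∘ ∈-select⁺ P?) (x∈p∩q⁻ D _ u∈)

  ∖P-mono : ∀ {D₁ D₂} → D₁ ⊆ D₂ → D₁ ∖P ⊆ D₂ ∖P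
  ∖P-mono D₁⊆D₂ u∈ = let u∈D₁ , ¬pu = ∈-∖P⁻ u∈ in ∈-∖P⁺ (D₁⊆D₂ u∈D₁) ¬pu

  ∈-decompose : ∀ {D} → select P? ⊆ D → (λ v → v ∈ D) ≐ (λ v → P v ⊎ v ∈ D ∖P)
  ∈-decompose {D} P⊆D v = mk⇔ split [ P⊆D ∘ ∈-select⁺ P? , proj₁ ∘ ∈-∖P⁻ ]′
    where
    split : v ∈ D → P v ⊎ v ∈ D ∖P
    split v∈D with P? v
    ... | yes pv = inj₁ pv
    ... | no ¬pv = inj₂ (∈-∖P⁺ v∈D ¬pv)

  decomposition-unique : ∀ {D D'} → (∀ {v} → v ∈ D' → ¬ P v) →
                         (λ v → v ∈ D) ≐ (λ v → P v ⊎ v ∈ D') → D' ≡ D ∖P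
  decomposition-unique {D} {D'} D'∩P≡∅ D≐ = ⊆-antisym D'⊆D∖P D∖P⊆D'
    where
    D'⊆D∖P : D' ⊆ D ∖P
    D'⊆D∖P v∈D' = ∈-∖P⁺ (from (D≐ _) (inj₂ v∈D')) (D'∩P≡∅ v∈D')
    D∖P⊆D' : D ∖P ⊆ D'
    D∖P⊆D' v∈ = let v∈D , ¬pv = ∈-∖P⁻ v∈ in [ flip contradiction ¬pv , id ]′ (to (D≐ _) v∈D)

  opposite⇒S : ∀ {v} → χ v ≡ opposite c → ¬ P v → S v
  opposite⇒S χv ¬pv (inj₁ pv)           = ¬pv pv
  opposite⇒S χv ¬pv (inj₂ (p , pp , a)) =
    opposite-≢ c (trans (sym (next-to-opposite G proper a (P-colour pp))) χv)

  P-dominates-outside-S : ∀ {E v} → select P? ⊆ E → χ v ≡ c → ¬ S v → N G (AllV G) E v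
  P-dominates-outside-S P⊆E χv ¬sv with ¬S⇒N[P] ¬sv
  ... | inj₁ pv           = contradiction (trans (sym χv) (P-colour pv)) (opposite-≢ c)
  ... | inj₂ (p , pp , a) = tt , p , P⊆E (∈-select⁺ P? pp) , a

  N-restrict : ∀ {D v} → N G S (D ∖P) v ⇔ (S v × N G (AllV G) D v)
  N-restrict {D} = mk⇔
    (λ (sv , u , u∈ , a) → sv , tt , u , proj₁ (∈-∖P⁻ u∈) , a)
    (λ (sv , _ , u , u∈D , a) → sv , u , ∈-∖P⁺ u∈D (λ pu → sv (inj₂ (u , pu , a))) , a)

  S-dominator-colour : ∀ {D u} → Dominating G S χ c D → u ∈ D → χ u ≡ opposite c
  S-dominator-colour {u = u} dom u∈D with has-nbr u
  ... | x , a with S? x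
  ...   | yes sx = dominator-colour G proper dom u∈D a sx
  ...   | no ¬sx with ¬S⇒N[P] ¬sx
  ...     | inj₁ px            = contradiction (inj₂ (x , px , Adj-sym G a)) (proj₁ dom u u∈D)
  ...     | inj₂ (p , pp , a') = next-to G proper a (next-to-opposite G proper a' (P-colour pp))

  dominating-split : ∀ {D} →
    Dominating G (AllV G) χ c D ⇔ (select P? ⊆ D × Dominating G S χ c (D ∖P))
  dominating-split {D} = mk⇔ restrict extend
    where
    restrict : Dominating G (AllV G) χ c D → select P? ⊆ D × Dominating G S χ c (D ∖P)
    restrict dom@(_ , N≐) = P⊆D , D∖P⊆S , N∖P≐
      where
      P⊆D : select P? ⊆ D
      P⊆D = P-forced dom ∘ ∈-select⁻ P?
      D∖P⊆S : ∀ u → u ∈ D ∖P → S u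
      D∖P⊆S u u∈ = let u∈D , ¬pu = ∈-∖P⁻ u∈
                       x , a = has-nbr u
                   in opposite⇒S (dominator-colour G proper dom u∈D a tt) ¬pu
      N∖P≐ : N G S (D ∖P) ≐ Colored G S χ c
      N∖P≐ v = mk⇔ (map₂ (proj₂ ∘ to (N≐ v)) ∘ to N-restrict)
                   (from N-restrict ∘ map₂ (λ χv → from (N≐ v) (tt , χv)))
    extend : select P? ⊆ D × Dominating G S χ c (D ∖P) → Dominating G (AllV G) χ c D
    extend (P⊆D , domS@(_ , N∖P≐)) = (λ _ _ → tt) , N≐
      where
      D-colour : ∀ {u} → u ∈ D → χ u ≡ opposite c
      D-colour {u} u∈D = [ P-colour , S-dominator-colour domS ]′ (to (∈-decompose P⊆D u) u∈D)
      N≐ : N G (AllV G) D ≐ Colored G (AllV G) χ c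
      N≐ v = mk⇔ (λ (_ , u , u∈D , a) → tt , next-to-opposite G proper a (D-colour u∈D)) dominated
        where
        dominated : Colored G (AllV G) χ c v → N G (AllV G) D v
        dominated (_ , χv) with S? v
        ... | yes sv = proj₂ (to N-restrict (from (N∖P≐ v) (sv , χv)))
        ... | no ¬sv = P-dominates-outside-S P⊆D χv ¬sv

  redundant-lift : ∀ {D} → Dominating G (AllV G) χ c D →
                   Redundant G S (D ∖P) → Redundant G (AllV G) D
  redundant-lift {D} dom@(_ , N≐) (D'' , (D''⊆ , x , x∈ , x∉D'') , N''≐) =
    select P? ∪ D'' , (E⊆D , x , x∈D , x∉E) , λ v → mk⇔ (N-mono G E⊆D) dominated
    where
    P⊆D : select P? ⊆ D
    P⊆D = proj₁ (to dominating-split dom)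
    x∈D : x ∈ D
    x∈D = proj₁ (∈-∖P⁻ x∈)
    ¬px : ¬ P x
    ¬px = proj₂ (∈-∖P⁻ x∈)
    E⊆D : select P? ∪ D'' ⊆ D
    E⊆D u∈ = [ P⊆D , proj₁ ∘ ∈-∖P⁻ ∘ D''⊆ ]′ (x∈p∪q⁻ _ _ u∈)
    x∉E : x ∉ select P? ∪ D''
    x∉E x∈E = [ ¬px ∘ ∈-select⁻ P? , x∉D'' ]′ (x∈p∪q⁻ _ _ x∈E)
    dominated : ∀ {v} → N G (AllV G) D v → N G (AllV G) (select P? ∪ D'') v
    dominated {v} nD with S? v
    ... | yes sv = N-mono G (x∈p∪q⁺ ∘ inj₂)
                     (N-forget G {S} (from (N''≐ v) (from N-restrict (sv , nD))))
    ... | no ¬sv = P-dominates-outside-S (x∈p∪q⁺ ∘ inj₁) (proj₂ (to (N≐ v) nD)) ¬sv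

  redundant-restrict : ∀ {D} → Dominating G (AllV G) χ c D →
                       Redundant G (AllV G) D → Redundant G S (D ∖P)
  redundant-restrict {D} (_ , N≐) (D'' , (D''⊆D , x , x∈D , x∉D'') , N''≐) =
    D'' ∖P , (∖P-mono D''⊆D , x , ∈-∖P⁺ x∈D ¬px , x∉D'' ∘ proj₁ ∘ ∈-∖P⁻) , N∖P≐
    where
    dom'' : Dominating G (AllV G) χ c D''
    dom'' = (λ _ _ → tt) , λ v → ⇔-trans (N''≐ v) (N≐ v)
    ¬px : ¬ P x
    ¬px = x∉D'' ∘ P-forced dom''
    N∖P≐ : N G S (D'' ∖P) ≐ N G S (D ∖P)
    N∖P≐ v = mk⇔ (from N-restrict ∘ map₂ (to (N''≐ v)) ∘ to N-restrict)
                 (from N-restrict ∘ map₂ (from (N''≐ v)) ∘ to N-restrict)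

  minimal-dominating-split : ∀ {D} →
    MinimalDominating G (AllV G) χ c D ⇔ (select P? ⊆ D × MinimalDominating G S χ c (D ∖P))
  minimal-dominating-split = mk⇔
    (λ (dom , irredundant) → let P⊆D , domS = to dominating-split dom
                             in P⊆D , domS , irredundant ∘ redundant-lift dom)
    (λ (P⊆D , domS , irredundantS) → let dom = from dominating-split (P⊆D , domS)
                                     in dom , irredundantS ∘ redundant-restrict dom)

  minimal-dominating-decomposition : ∀ D → MinimalDominating G (AllV G) χ c D ⇔
            (∃ λ D' → MinimalDominating G S χ c D' × ((λ v → v ∈ D) ≐ (λ v → P v ⊎ v ∈ D')))
  minimal-dominating-decomposition D = mk⇔
    (λ minD → let P⊆D , minS = to minimal-dominating-split minD
              in D ∖P , minS , ∈-decompose P⊆D)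
    (λ (D' , minS@((D'⊆S , _) , _) , D≐) →
      from minimal-dominating-split
        ( (λ u∈P → from (D≐ _) (inj₁ (∈-select⁻ P? u∈P)))
        , subst (MinimalDominating G S χ c)
                (decomposition-unique (λ {v} v∈D' → D'⊆S v v∈D' ∘ inj₁) D≐) minS))

module _ {n : ℕ} (T : Graph n) where

  leaf-nbr-unique : ∀ {ℓ x y} → Leaf T ℓ → Adj T ℓ x → Adj T ℓ y → x ≡ y
  leaf-nbr-unique leaf a b = ∣p∣≡1⇒x≡y leaf (∈-tabulate⁺ a) (∈-tabulate⁺ b)

  V₁⇒¬Leaf : ∀ {v} → V₁ T v → ¬ Leaf T v
  V₁⇒¬Leaf (_ , nearest) leaf with nearest _ 0 leaf []
  ... | ()

  V₁⇒leaf-nbr : ∀ {v} → V₁ T v → ∃ λ ℓ → Leaf T ℓ × Adj T v ℓ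
  V₁⇒leaf-nbr {v} v₁@((_ , leaf , _ , m≤1 , walk) , _) = first-step walk m≤1 leaf
    where
    first-step : ∀ {ℓ m} → Walk T v ℓ m → m ≤ 1 → Leaf T ℓ → ∃ λ ℓ → Leaf T ℓ × Adj T v ℓ
    first-step []            _        leaf = contradiction leaf (V₁⇒¬Leaf v₁)
    first-step (a ∷ [])      _        leaf = _ , leaf , a
    first-step (_ ∷ (_ ∷ _)) (s≤s ()) _

  leaf-nbr⇒V₁ : ∀ {v ℓ} → ¬ Leaf T v → Leaf T ℓ → Adj T v ℓ → V₁ T v
  leaf-nbr⇒V₁ {v} ¬leaf leaf a = (_ , leaf , 1 , ≤-refl , a ∷ []) , nearest
    where
    nearest : ∀ ℓ m → Leaf T ℓ → Walk T v ℓ m → 1 ≤ m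
    nearest _ _ leaf′ []      = contradiction leaf′ ¬leaf
    nearest _ _ _     (_ ∷ _) = s≤s z≤n

  V₁? : Decidable (V₁ T)
  V₁? v = map′ (λ (¬leaf , _ , leaf , a) → leaf-nbr⇒V₁ ¬leaf leaf a)
               (λ v₁ → V₁⇒¬Leaf v₁ , V₁⇒leaf-nbr v₁)
               (¬? (Leaf? v) ×-dec any? (λ ℓ → Leaf? ℓ ×-dec (Graph.adj T v ℓ Bool.≟ true)))
    where
    Leaf? : Decidable (Leaf T)
    Leaf? ℓ = degree T ℓ ℕ.≟ 1

  V₁-forced : ∀ {χ c D v} → ProperColoring T χ → Dominating T (AllV T) χ c D →
              V₁ T v → χ v ≡ opposite c → v ∈ D
  V₁-forced {D = D} proper (_ , N≐) v₁ χv with V₁⇒leaf-nbr v₁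
  ... | ℓ , leaf , a with from (N≐ ℓ) (tt , next-to-opposite T proper a χv)
  ...   | _ , u , u∈D , a′ = subst (_∈ D) (leaf-nbr-unique leaf (Adj-sym T a′) (Adj-sym T a)) u∈D

lemma5p6 : (n : ℕ) (T : Graph n) (χ : Fin n → Color) →
             2 ≤ n → IsTree T → ProperColoring T χ → (D : Subset n) →
             (MinimalDominating T (AllV T) χ blue D ⇔
               (∃ λ D' → MinimalDominating T (RemovedV T χ red) χ blue D'
                 × ((λ v → v ∈ D) ≐ (λ v → (V₁ T v × χ v ≡ red) ⊎ v ∈ D'))))
             × (MinimalDominating T (AllV T) χ red D ⇔
               (∃ λ D' → MinimalDominating T (RemovedV T χ blue) χ red D'
                 × ((λ v → v ∈ D) ≐ (λ v → (V₁ T v × χ v ≡ blue) ⊎ v ∈ D'))))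
lemma5p6 n T χ 2≤n (connected , _) proper D = split blue , split red
  where
  split : ∀ c → MinimalDominating T (AllV T) χ c D ⇔
          (∃ λ D' → MinimalDominating T (RemovedV T χ (opposite c)) χ c D'
            × ((λ v → v ∈ D) ≐ (λ v → (V₁ T v × χ v ≡ opposite c) ⊎ v ∈ D')))
  split c = ForcedVertices.minimal-dominating-decomposition T proper c
              (connected⇒nbr T 2≤n connected)
              (λ v → V₁? T v ×-dec (χ v ≟ᶜ opposite c)) proj₂
              (λ dom (v₁ , χv) → V₁-forced T proper dom v₁ χv) D
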